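{- In the setting described in the context, let $t\in\mathbf I$, $n<\omega$, $g_1,g_2\in H^t_n$ and $f_1,f_2\in G_\omega$, and suppose $(g_1,f_1)$ and $(g_2,f_2)$ are nice $t$-pairs. Then: (1) $(g_1g_2,f_1f_2)$ is a nice $t$-pair and $\mathrm{rk}_t(g_1g_2,f_1f_2)\ge\min\{\mathrm{rk}_t(g_1,f_1),\mathrm{rk}_t(g_2,f_2)\}$. (2) If $\mathrm{rk}_t(g_1,f_1)\ne\mathrm{rk}_t(g_2,f_2)$, then $\mathrm{rk}_t(g_1g_2,f_1f_2)=\min\{\mathrm{rk}_t(g_1,f_1),\mathrm{rk}_t(g_2,f_2)\}$.
   Context: Setting: $\langle G_m,\pi_{m,n}:m\le n<\omega\rangle$ is an inverse system of groups (homomorphisms $\pi_{m,n}:G_n\to G_m$, $\pi_{\alpha,\beta}\circ\pi_{\beta,\gamma}=\pi_{\alpha,\gamma}$, $\pi_{\alpha,\alpha}=\mathrm{id}$) with inverse limit $G_\omega$ and projections $\pi_{n,\omega}$; $\mathbf I$ is a finite set and for each $t\in\mathbf I$, $\langle H^t_m,\pi^t_{m,n}\rangle$ is an inverse system of groups; $\sigma^t_n:H^t_n\to G_n$ are homomorphisms with $\pi_{m,n}\circ\sigma^t_n=\sigma^t_m\circ\pi^t_{m,n}$. For $f\in G_\omega$ write $f\restriction G_n=\pi_{n,\omega}(f)$. Nice pairs: for $g\in H^t_n$ and $f\in G_\omega$, $(g,f)$ is a nice $t$-pair if $\sigma^t_n(g)=f\restriction G_n$. Rank: by induction on ordinals $\alpha$,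 simultaneously for all $n<\omega$ and $g\in H^t_n$: $\mathrm{rk}_t(g,f)\ge 0$ iff $(g,f)$ is a nice $t$-pair; for limit $\delta$, $\mathrm{rk}_t(g,f)\ge\delta$ iff $\mathrm{rk}_t(g,f)\ge\beta$ for all $\beta<\delta$; $\mathrm{rk}_t(g,f)\ge\beta+1$ iff $(g,f)$ is a nice $t$-pair and there is $g'\in H^t_{n+1}$ with $\pi^t_{n,n+1}(g')=g$ and $\mathrm{rk}_t(g',f)\ge\beta$. Always $\mathrm{rk}_t(g,f)\ge -1$. $\mathrm{rk}_t(g,f)=\alpha$ iff $\ge\alpha$ but not $\ge\alpha+1$; $\mathrm{rk}_t(g,f)=\infty$ iff $\ge\alpha$ for every ordinal $\alpha$ (values ordered with $-1<$ every ordinal $<\infty$). -}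

module Defs where

open import Level using (Level; _⊔_) renaming (suc to lsuc)
open import Data.Nat using (ℕ; zero; suc; _≤_)
open import Data.Nat.Properties using (n≤1+n)
open import Data.Fin using (Fin)
open import Data.Product using (Σ; _×_; _,_)
open import Relation.Nullary using (¬_)
open import Function.Bundles using (_⇔_)
open import Algebra.Bundles using (Group)
open import Algebra.Morphism.Structures using (module GroupMorphisms)

Hom : ∀ {c ℓ} (A B : Group c ℓ) → (Group.Carrier A → Group.Carrier B) → Set (c ⊔ ℓ)
Hom A B f = GroupMorphisms.IsGroupHomomorphism (Group.rawGroup A) (Group.rawGroup B) f

record InverseSystem (c ℓ : Level) : Set (lsuc (c ⊔ ℓ)) where
  field
    G      : ℕ → Group c ℓ
    π      : ∀ {m n} → m ≤ n → Group.Carrier (G n) → Group.Carrier (G m)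
    π-hom  : ∀ {m n} (p : m ≤ n) → Hom (G n) (G m) (π p)
    π-id   : ∀ {n} (p : n ≤ n) (x : Group.Carrier (G n)) → Group._≈_ (G n) (π p x) x
    π-comp : ∀ {k m n} (p : k ≤ m) (q : m ≤ n) (r : k ≤ n) (x : Group.Carrier (G n)) →
             Group._≈_ (G k) (π p (π q x)) (π r x)

  Car : ℕ → Set c
  Car n = Group.Carrier (G n)

  -- elements of the inverse limit G_ω: coherent threads (f restricted to G_n is f n)
  IsThread : ((n : ℕ) → Car n) → Set ℓ
  IsThread f = ∀ {m n} (p : m ≤ n) → Group._≈_ (G m) (π p (f n)) (f m)

  _·ω_ : ((n : ℕ) → Car n) → ((n : ℕ) → Car n) → ((n : ℕ) → Car n)
  (f₁ ·ω f₂) n = Group._∙_ (G n) (f₁ n) (f₂ n)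

record Setting (c ℓ : Level) : Set (lsuc (c ⊔ ℓ)) where
  field
    𝔾     : InverseSystem c ℓ
    k     : ℕ
    ℍ     : Fin k → InverseSystem c ℓ
    σ     : (t : Fin k) (n : ℕ) → InverseSystem.Car (ℍ t) n → InverseSystem.Car 𝔾 n
    σ-hom : (t : Fin k) (n : ℕ) → Hom (InverseSystem.G (ℍ t) n) (InverseSystem.G 𝔾 n) (σ t n)
    σ-comm : (t : Fin k) {m n : ℕ} (p : m ≤ n) (x : InverseSystem.Car (ℍ t) n) →
             Group._≈_ (InverseSystem.G 𝔾 m)
               (InverseSystem.π 𝔾 p (σ t n x)) (σ t m (InverseSystem.π (ℍ t) p x))

-- Ordinals, as Brouwer-style well-founded trees with limits indexed by types in Set c.
data Ord (c : Level) : Set (lsuc c) where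
  ozero : Ord c
  osuc  : Ord c → Ord c
  olim  : (A : Set c) → (A → Ord c) → Ord c

module _ {c ℓ : Level} (𝒮 : Setting c ℓ) (t : Fin (Setting.k 𝒮)) where
  open Setting 𝒮
  private
    module G = InverseSystem 𝔾
    module H = InverseSystem (ℍ t)
    Th : Set c
    Th = (m : ℕ) → G.Car m

  Nice : (n : ℕ) → H.Car n → ((m : ℕ) → G.Car m) → Set ℓ
  Nice n g f = Group._≈_ (G.G n) (σ t n g) (f n)

  -- rk_t(g , f) ≥ α
  RkGe : (n : ℕ) → H.Car n → ((m : ℕ) → G.Car m) → Ord c → Set (c ⊔ ℓ)
  RkGe n g f ozero      = Level.Lift c (Nice n g f)
  RkGe n g f (osuc α)   = Nice n g f ×
    Σ (H.Car (suc n)) (λ g′ → Group._≈_ (H.G n) (H.π (n≤1+n n) g′) g × RkGe (suc n) g′ f α)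
  RkGe n g f (olim A h) = Nice n g f × (∀ a → RkGe n g f (h a))

  RkGeMin : (n : ℕ) (g : H.Car n) (f : Th) (g₁ : H.Car n) (f₁ : Th) (g₂ : H.Car n) (f₂ : Th) → Set (lsuc c ⊔ ℓ)
  RkGeMin n g f g₁ f₁ g₂ f₂ =
    ∀ α → RkGe n g₁ f₁ α → RkGe n g₂ f₂ α → RkGe n g f α

  -- rk_t(g , f) = rk_t(g′ , f′)  (same ranks: same ordinals below them)
  RkEq : (n : ℕ) (g : H.Car n) (f : Th) (g′ : H.Car n) (f′ : Th) → Set (lsuc c ⊔ ℓ)
  RkEq n g f g′ f′ = ∀ α → RkGe n g f α ⇔ RkGe n g′ f′ α

  RkEqMin : (n : ℕ) (g : H.Car n) (f : Th) (g₁ : H.Car n) (f₁ : Th) (g₂ : H.Car n) (f₂ : Th) → Set (lsuc c ⊔ ℓ)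
  RkEqMin n g f g₁ f₁ g₂ f₂ =
    ∀ α → RkGe n g f α ⇔ (RkGe n g₁ f₁ α × RkGe n g₂ f₂ α)

{-# OPTIONS --safe #-}
module Submission where

-- Nice pairs form a subgroup of H^t_n × G_ω, and each condition rk ≥ α is
-- preserved by the componentwise group operations because σ^t and π^t are
-- homomorphisms; this is (1). Applied to (g₁,f₁) = (g₁g₂,f₁f₂)(g₂,f₂)⁻¹ and
-- (g₂,f₂) = (g₁,f₁)⁻¹(g₁g₂,f₁f₂), (1) bounds each factor's rank below by the
-- minimum of the product's rank and the other factor's rank. Ranks are
-- linearly ordered (classically: the order on ordinals is total and the
-- conditions rk ≥ α are downward closed), so the isosceles argument for
-- ultrametrics gives (2).

open import Defs
open import Level using (Level; _⊔_; Lift; lift; lower) renaming (suc to lsuc)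
open import Data.Nat using (ℕ; suc)
open import Data.Nat.Properties using (n≤1+n)
open import Data.Fin using (Fin)
open import Data.Product using (Σ; _×_; _,_; curry)
open import Data.Sum using (_⊎_; inj₁; inj₂; [_,_]′)
open import Data.Unit.Polymorphic using (⊤; tt)
open import Data.Empty using (⊥-elim)
open import Data.Empty.Polymorphic using (⊥)
open import Function using (id)
open import Function.Bundles using (mk⇔)
open import Relation.Nullary using (¬_; yes; no; contradiction)
open import Relation.Nullary.Decidable using (map′; decidable-stable)
open import Relation.Unary using (Pred; _⊆_; _∩_; _≐_)
open import Algebra.Bundles using (Group)
open import Algebra.Morphism.Structures using (module GroupMorphisms)
import Algebra.Properties.Group as GroupProperties
open import Axiom.ExcludedMiddle using (ExcludedMiddle)

lowerEM : ∀ {a} b → ExcludedMiddle (a ⊔ b) → ExcludedMiddle a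
lowerEM b em = map′ lower lift (em {Lift b _})

module _ {c : Level} where

  infix 4 _≤ᵒ_ _<ᵒ_
  _≤ᵒ_ _<ᵒ_ : Ord c → Ord c → Set c
  ozero    ≤ᵒ β = ⊤
  osuc α   ≤ᵒ β = α <ᵒ β
  olim A h ≤ᵒ β = ∀ a → h a ≤ᵒ β
  α <ᵒ ozero    = ⊥
  α <ᵒ osuc β   = α ≤ᵒ β
  α <ᵒ olim B k = Σ B λ b → α <ᵒ k b

  ≤ᵒ-osuc : ∀ {α β} → α ≤ᵒ β → α ≤ᵒ osuc β
  ≤ᵒ-olim : ∀ {α B k} (b : B) → α ≤ᵒ k b → α ≤ᵒ olim B k
  <ᵒ⇒≤ᵒ   : ∀ {α β} → α <ᵒ β → α ≤ᵒ β

  ≤ᵒ-osuc {ozero}    _   = tt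
  ≤ᵒ-osuc {osuc α}   α<β = <ᵒ⇒≤ᵒ {α} α<β
  ≤ᵒ-osuc {olim A h} h≤β = λ a → ≤ᵒ-osuc {h a} (h≤β a)

  ≤ᵒ-olim {ozero}    b _    = tt
  ≤ᵒ-olim {osuc α}   b α<kb = b , α<kb
  ≤ᵒ-olim {olim A h} b h≤kb = λ a → ≤ᵒ-olim {h a} b (h≤kb a)

  <ᵒ⇒≤ᵒ {α} {osuc β}   α≤β        = ≤ᵒ-osuc {α} {β} α≤β
  <ᵒ⇒≤ᵒ {α} {olim B k} (b , α<kb) = ≤ᵒ-olim {α} b (<ᵒ⇒≤ᵒ {α} {k b} α<kb)

  module _ (em : ExcludedMiddle c) where

    ≤ᵒ-or->ᵒ : ∀ α β → α ≤ᵒ β ⊎ β <ᵒ α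
    <ᵒ-or-≥ᵒ : ∀ α β → α <ᵒ β ⊎ β ≤ᵒ α

    ≤ᵒ-or->ᵒ ozero      β = inj₁ tt
    ≤ᵒ-or->ᵒ (osuc α)   β = <ᵒ-or-≥ᵒ α β
    ≤ᵒ-or->ᵒ (olim A h) β with em {Σ A λ a → β <ᵒ h a}
    ... | yes β<h = inj₂ β<h
    ... | no  β≮h = inj₁ λ a →
      [ id , (λ β<ha → contradiction (a , β<ha) β≮h) ]′ (≤ᵒ-or->ᵒ (h a) β)

    <ᵒ-or-≥ᵒ α ozero      = inj₂ tt
    <ᵒ-or-≥ᵒ α (osuc β)   = ≤ᵒ-or->ᵒ α β
    <ᵒ-or-≥ᵒ α (olim B k) with em {Σ B λ b → α <ᵒ k b}
    ... | yes α<k = inj₁ α<k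
    ... | no  α≮k = inj₂ λ b →
      [ (λ α<kb → contradiction (b , α<kb) α≮k) , id ]′ (<ᵒ-or-≥ᵒ α (k b))

    ≤ᵒ-total : ∀ α β → α ≤ᵒ β ⊎ β ≤ᵒ α
    ≤ᵒ-total α β = [ inj₁ , (λ β<α → inj₂ (<ᵒ⇒≤ᵒ {β} {α} β<α)) ]′ (≤ᵒ-or->ᵒ α β)

  Downward : ∀ {p} → Pred (Ord c) p → Set (lsuc c ⊔ p)
  Downward P = ∀ {α β} → α ≤ᵒ β → P β → P α

  downward-comparable : ∀ {p} {P Q : Pred (Ord c) p} → ExcludedMiddle (lsuc c ⊔ p) →
                        Downward P → Downward Q → P ⊆ Q ⊎ Q ⊆ P
  downward-comparable {p} {P} {Q} em ↓P ↓Q with em {P ⊆ Q}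
  ... | yes P⊆Q = inj₁ P⊆Q
  ... | no  P⊈Q = inj₂ Q⊆P
    where
    Q⊆P : Q ⊆ P
    Q⊆P {β} Qβ = decidable-stable (lowerEM (lsuc c) em) λ ¬Pβ → P⊈Q λ {α} Pα →
      [ (λ α≤β → ↓Q α≤β Qβ) , (λ β≤α → contradiction (↓P β≤α Pα) ¬Pβ) ]′
        (≤ᵒ-total (lowerEM (lsuc c ⊔ p) em) α β)

isosceles : ∀ {a p} {X : Set a} {A B P : Pred X p} →
            P ⊆ A ⊎ A ⊆ P → P ⊆ B ⊎ B ⊆ P → P ∩ B ⊆ A → A ∩ P ⊆ B → ¬ (A ≐ B) →
            P ⊆ A ∩ B
isosceles _          (inj₁ P⊆B) PB⊆A _    _   Px = PB⊆A (Px , P⊆B Px) , P⊆B Px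
isosceles (inj₁ P⊆A) (inj₂ _)   _    AP⊆B _   Px = P⊆A Px , AP⊆B (P⊆A Px , Px)
isosceles (inj₂ A⊆P) (inj₂ B⊆P) PB⊆A AP⊆B A≉B _  =
  ⊥-elim (A≉B ((λ Ax → AP⊆B (Ax , A⊆P Ax)) , (λ Bx → PB⊆A (B⊆P Bx , Bx))))

module Rank {c ℓ} (𝒮 : Setting c ℓ) (t : Fin (Setting.k 𝒮)) where
  open Setting 𝒮
  private
    module G = InverseSystem 𝔾
    module H = InverseSystem (ℍ t)
    module Gₙ (n : ℕ) = Group (G.G n)
    module Hₙ (n : ℕ) = Group (H.G n)
    module σₙ (n : ℕ) = GroupMorphisms.IsGroupHomomorphism (σ-hom t n)
    module πₙ (n : ℕ) = GroupMorphisms.IsGroupHomomorphism (H.π-hom (n≤1+n n))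

  Seq : Set c
  Seq = (m : ℕ) → G.Car m

  _⁻¹ω : Seq → Seq
  (f ⁻¹ω) m = Gₙ._⁻¹ m (f m)

  infix 4 _≈ω_
  _≈ω_ : Seq → Seq → Set ℓ
  f ≈ω f′ = ∀ m → Gₙ._≈_ m (f m) (f′ m)

  Rk : (n : ℕ) → H.Car n → Seq → Pred (Ord c) (c ⊔ ℓ)
  Rk = RkGe 𝒮 t

  RkGe⇒Nice : ∀ {n g f} α → Rk n g f α → Nice 𝒮 t n g f
  RkGe⇒Nice ozero      (lift nice) = nice
  RkGe⇒Nice (osuc α)   (nice , _)  = nice
  RkGe⇒Nice (olim A h) (nice , _)  = nice

  RkGe-downward : ∀ {n g f} → Downward (Rk n g f)
  RkGe-downward {α = ozero}    {β}        _          r                   = lift (RkGe⇒Nice β r)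
  RkGe-downward {α = osuc α}   {osuc β}   α≤β        (nice , g′ , e , r) = nice , g′ , e , RkGe-downward α≤β r
  RkGe-downward {α = osuc α}   {olim B k} (b , α<kb) (_ , r)             = RkGe-downward {α = osuc α} α<kb (r b)
  RkGe-downward {α = olim A h} {β}        h≤β        r                   =
    RkGe⇒Nice β r , λ a → RkGe-downward (h≤β a) r

  Nice-cong : ∀ {n g g′ f f′} → Hₙ._≈_ n g g′ → f ≈ω f′ → Nice 𝒮 t n g f → Nice 𝒮 t n g′ f′
  Nice-cong {n} g≈g′ f≈f′ nice =
    Gₙ.trans n (Gₙ.sym n (σₙ.⟦⟧-cong n g≈g′)) (Gₙ.trans n nice (f≈f′ n))

  RkGe-cong : ∀ {n g g′ f f′} → Hₙ._≈_ n g g′ → f ≈ω f′ → Rk n g f ⊆ Rk n g′ f′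
  RkGe-cong g≈g′ f≈f′ {x = ozero} (lift nice) = lift (Nice-cong g≈g′ f≈f′ nice)
  RkGe-cong {n} g≈g′ f≈f′ {x = osuc α} (nice , g₊ , e , r) =
    Nice-cong g≈g′ f≈f′ nice , g₊ , Hₙ.trans n e g≈g′ , RkGe-cong (Hₙ.refl (suc n)) f≈f′ r
  RkGe-cong g≈g′ f≈f′ {x = olim A h} (nice , r) =
    Nice-cong g≈g′ f≈f′ nice , λ a → RkGe-cong g≈g′ f≈f′ (r a)

  Nice-∙ : ∀ {n g₁ g₂ f₁ f₂} → Nice 𝒮 t n g₁ f₁ → Nice 𝒮 t n g₂ f₂ →
           Nice 𝒮 t n (Hₙ._∙_ n g₁ g₂) (f₁ G.·ω f₂)
  Nice-∙ {n} {g₁} {g₂} nice₁ nice₂ = Gₙ.trans n (σₙ.homo n g₁ g₂) (Gₙ.∙-cong n nice₁ nice₂)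

  RkGe-∙ : ∀ {n g₁ g₂ f₁ f₂} → Rk n g₁ f₁ ∩ Rk n g₂ f₂ ⊆ Rk n (Hₙ._∙_ n g₁ g₂) (f₁ G.·ω f₂)
  RkGe-∙ {f₁ = f₁} {f₂} {ozero} (lift nice₁ , lift nice₂) = lift (Nice-∙ {f₁ = f₁} {f₂} nice₁ nice₂)
  RkGe-∙ {n} {f₁ = f₁} {f₂} {osuc α} ((nice₁ , g₁₊ , e₁ , r₁) , (nice₂ , g₂₊ , e₂ , r₂)) =
    Nice-∙ {f₁ = f₁} {f₂} nice₁ nice₂ , Hₙ._∙_ (suc n) g₁₊ g₂₊ ,
    Hₙ.trans n (πₙ.homo n g₁₊ g₂₊) (Hₙ.∙-cong n e₁ e₂) , RkGe-∙ (r₁ , r₂)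
  RkGe-∙ {f₁ = f₁} {f₂} {olim A h} ((nice₁ , r₁) , (nice₂ , r₂)) =
    Nice-∙ {f₁ = f₁} {f₂} nice₁ nice₂ , λ a → RkGe-∙ (r₁ a , r₂ a)

  Nice-⁻¹ : ∀ {n g f} → Nice 𝒮 t n g f → Nice 𝒮 t n (Hₙ._⁻¹ n g) (f ⁻¹ω)
  Nice-⁻¹ {n} {g} nice = Gₙ.trans n (σₙ.⁻¹-homo n g) (Gₙ.⁻¹-cong n nice)

  RkGe-⁻¹ : ∀ {n g f} → Rk n g f ⊆ Rk n (Hₙ._⁻¹ n g) (f ⁻¹ω)
  RkGe-⁻¹ {f = f} {ozero} (lift nice) = lift (Nice-⁻¹ {f = f} nice)
  RkGe-⁻¹ {n} {f = f} {osuc α} (nice , g₊ , e , r) =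
    Nice-⁻¹ {f = f} nice , Hₙ._⁻¹ (suc n) g₊ , Hₙ.trans n (πₙ.⁻¹-homo n g₊) (Hₙ.⁻¹-cong n e) ,
    RkGe-⁻¹ r
  RkGe-⁻¹ {f = f} {olim A h} (nice , r) = Nice-⁻¹ {f = f} nice , λ a → RkGe-⁻¹ (r a)

  RkGe-cancelʳ : ∀ {n g₁ g₂ f₁ f₂} → Rk n (Hₙ._∙_ n g₁ g₂) (f₁ G.·ω f₂) ∩ Rk n g₂ f₂ ⊆ Rk n g₁ f₁
  RkGe-cancelʳ {n} {g₁} {g₂} {f₁} {f₂} (r , r₂) =
    RkGe-cong (//-rightDividesʳ g₂ g₁) (λ m → GroupProperties.//-rightDividesʳ (G.G m) (f₂ m) (f₁ m))
      (RkGe-∙ (r , RkGe-⁻¹ r₂))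
    where open GroupProperties (H.G n)

  RkGe-cancelˡ : ∀ {n g₁ g₂ f₁ f₂} → Rk n g₁ f₁ ∩ Rk n (Hₙ._∙_ n g₁ g₂) (f₁ G.·ω f₂) ⊆ Rk n g₂ f₂
  RkGe-cancelˡ {n} {g₁} {g₂} {f₁} {f₂} (r₁ , r) =
    RkGe-cong (\\-leftDividesʳ g₁ g₂) (λ m → GroupProperties.\\-leftDividesʳ (G.G m) (f₁ m) (f₂ m))
      (RkGe-∙ (RkGe-⁻¹ r₁ , r))
    where open GroupProperties (H.G n)

  RkGe-comparable : ExcludedMiddle (lsuc c ⊔ ℓ) → ∀ {n g f g′ f′} →
                    Rk n g f ⊆ Rk n g′ f′ ⊎ Rk n g′ f′ ⊆ Rk n g f
  RkGe-comparable em = downward-comparable em RkGe-downward RkGe-downward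

  RkGe-∙-reflects : ExcludedMiddle (lsuc c ⊔ ℓ) → ∀ {n g₁ g₂ f₁ f₂} →
                    ¬ (Rk n g₁ f₁ ≐ Rk n g₂ f₂) →
                    Rk n (Hₙ._∙_ n g₁ g₂) (f₁ G.·ω f₂) ⊆ Rk n g₁ f₁ ∩ Rk n g₂ f₂
  RkGe-∙-reflects em =
    isosceles (RkGe-comparable em) (RkGe-comparable em) RkGe-cancelʳ RkGe-cancelˡ

lemma1p8 : ∀ {c ℓ} (𝒮 : Setting c ℓ) (t : Fin (Setting.k 𝒮)) (n : ℕ)
    (g₁ g₂ : InverseSystem.Car (Setting.ℍ 𝒮 t) n)
    (f₁ f₂ : (m : ℕ) → InverseSystem.Car (Setting.𝔾 𝒮) m) →
    InverseSystem.IsThread (Setting.𝔾 𝒮) f₁ →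
    InverseSystem.IsThread (Setting.𝔾 𝒮) f₂ →
    Nice 𝒮 t n g₁ f₁ → Nice 𝒮 t n g₂ f₂ →
    (Nice 𝒮 t n (Group._∙_ (InverseSystem.G (Setting.ℍ 𝒮 t) n) g₁ g₂) (InverseSystem._·ω_ (Setting.𝔾 𝒮) f₁ f₂)
      × RkGeMin 𝒮 t n (Group._∙_ (InverseSystem.G (Setting.ℍ 𝒮 t) n) g₁ g₂) (InverseSystem._·ω_ (Setting.𝔾 𝒮) f₁ f₂) g₁ f₁ g₂ f₂)
    × (ExcludedMiddle (lsuc (c ⊔ ℓ)) →
       ¬ RkEq 𝒮 t n g₁ f₁ g₂ f₂ →
       RkEqMin 𝒮 t n (Group._∙_ (InverseSystem.G (Setting.ℍ 𝒮 t) n) g₁ g₂) (InverseSystem._·ω_ (Setting.𝔾 𝒮) f₁ f₂) g₁ f₁ g₂ f₂)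
lemma1p8 {ℓ = ℓ} 𝒮 t n g₁ g₂ f₁ f₂ _ _ nice₁ nice₂ =
  (Nice-∙ {f₁ = f₁} {f₂} nice₁ nice₂ , λ α → curry (RkGe-∙ {x = α})) ,
  λ em rk₁≠rk₂ α →
    mk⇔ (RkGe-∙-reflects (lowerEM (lsuc ℓ) em) (λ (⊆₁₂ , ⊇₁₂) → rk₁≠rk₂ λ β → mk⇔ ⊆₁₂ ⊇₁₂) {α})
        (RkGe-∙ {x = α})
  where open Rank 𝒮 t
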